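{- Assume $\Gamma$ has no slices. Then every mincut of $\Gamma$ is either an A-cut or a B-cut.
   Context: $\Gamma=(V,E)$ is a connected graph. For $K\subseteq V$, $\Gamma-K$ is $\Gamma$ with $K$ and incident edges deleted. A vertex cut is a finite $K\subseteq V$ with $\Gamma-K$ disconnected. A ray is an infinite sequence of distinct vertices with consecutive ones adjacent; rays $r_1,r_2$ are equivalent if for every vertex cut $K$ all but finitely many vertices of $r_1\cup r_2$ lie in one component of $\Gamma-K$; ends are the equivalence classes. An end cut is a vertex cut $K$ such that at least two components of $\Gamma-K$ contain rays; it is assumed end cuts exist, and a mincut is an end cut of minimal cardinality. $\Gamma$ has no slices means: for every mincut $K$, every component of $\Gamma-K$ contains a ray. Two mincuts $K,L$ are nested if there are components $E$ of $\Gamma-K$ and $F$ of $\Gamma-L$ with $E\subseteq F$ or $F\subseteq E$. An A-cut is a mincut nested with all other mincuts; a B-cut is a mincut $K$ such that $\Gamma-K$ has exactly two components. -}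

module Defs where

open import Level using (0ℓ)
open import Data.Nat using (ℕ; suc; _≤_)
open import Data.List using (List; length)
open import Data.List.Membership.Propositional using (_∈_; _∉_)
open import Data.List.Relation.Unary.Unique.Propositional using (Unique)
open import Data.Product using (Σ; ∃; ∃-syntax; _×_; _,_)
open import Data.Sum using (_⊎_)
open import Relation.Nullary using (¬_)
open import Relation.Binary.PropositionalEquality using (_≡_)
open import Function.Definitions using (Injective)

record Graph : Set₁ where
  field
    V    : Set
    _~_  : V → V → Set
    ~-sym : ∀ {u v} → u ~ v → v ~ u

module _ (Γ : Graph) where
  open Graph Γ

  -- Paths in Γ - K (all vertices of the path avoid the finite set K).
  data Path (K : List V) : V → V → Set where
    stop : ∀ {u} → u ∉ K → Path K u u
    step : ∀ {u w v} → u ∉ K → u ~ w → Path K w v → Path K u v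

  Connected : Set
  Connected = ∀ u v → Path Data.List.[] u v

  Disconnected : List V → Set
  Disconnected K = ∃[ u ] ∃[ v ] (u ∉ K × v ∉ K × ¬ Path K u v)

  VertexCut : List V → Set
  VertexCut K = Disconnected K

  IsComponent : List V → (V → Set) → Set
  IsComponent K C =
    (∃[ v ] C v)
    × (∀ v → C v → v ∉ K)
    × (∀ u v → C u → C v → Path K u v)
    × (∀ u v → C u → Path K u v → C v)

  _⊆ᵥ_ : (V → Set) → (V → Set) → Set
  C ⊆ᵥ D = ∀ v → C v → D v

  _≐_ : (V → Set) → (V → Set) → Set
  C ≐ D = (C ⊆ᵥ D) × (D ⊆ᵥ C)

  record Ray : Set where
    field
      seq   : ℕ → V
      inj   : Injective _≡_ _≡_ seq
      adj   : ∀ n → seq n ~ seq (suc n)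
  open Ray public

  HasRay : (V → Set) → Set
  HasRay C = Σ Ray λ r → ∀ n → C (seq r n)

  EndCut : List V → Set₁
  EndCut K = VertexCut K ×
    (∃[ C ] ∃[ D ] (IsComponent K C × IsComponent K D × ¬ (C ≐ D)
                    × HasRay C × HasRay D))

  -- Mincut: an end cut of minimal cardinality (K is duplicate-free so
  -- its length is its cardinality).
  Mincut : List V → Set₁
  Mincut K = Unique K × EndCut K ×
    (∀ L → Unique L → EndCut L → length K ≤ length L)

  NoSlices : Set₁
  NoSlices = ∀ K → Mincut K → ∀ C → IsComponent K C → HasRay C

  Nested : List V → List V → Set₁
  Nested K L = ∃[ C ] ∃[ D ]
    (IsComponent K C × IsComponent L D × (C ⊆ᵥ D ⊎ D ⊆ᵥ C))

  ACut : List V → Set₁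
  ACut K = Mincut K × (∀ L → Mincut L → Nested K L)

  BCut : List V → Set₁
  BCut K = Mincut K ×
    (∃[ C ] ∃[ D ] (IsComponent K C × IsComponent K D × ¬ (C ≐ D)
                    × (∀ E → IsComponent K E → (E ≐ C) ⊎ (E ≐ D))))

-- Suppose the mincut K is not a B-cut, so Γ - K has a third component besides
-- any two given ones, and that K is not nested with a mincut L; then every
-- component of Γ - K meets L, since one avoiding L would lie inside a
-- component of Γ - L. Tails of the rays in two components of Γ - L, together
-- with the ray of a further component of Γ - K (no slices), yield components
-- C ≠ C' of Γ - K and D ≠ D' of Γ - L with rays in C ∩ D and C' ∩ D'. The
-- boundaries N of the corner C ∩ D and N' of the corner C' ∩ D' separate these
-- rays, so |K| ≤ |N| and |K| ≤ |N'|. But a component Z of Γ - K other than C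
-- and C' meets L, and no vertex of Z lies in N or N', so
-- |N| + |N'| < |K| + |L| ≤ 2|K|.
module Submission where

open import Defs
open import Level using (0ℓ)
open import Data.List using (List)
open import Data.Product using (∃-syntax)
open import Data.Sum using (_⊎_)
open import Axiom.ExcludedMiddle using (ExcludedMiddle)

open import Algebra.Properties.CommutativeSemigroup using (interchange)
open import Data.Empty using (⊥; ⊥-elim)
open import Data.List using ([]; _∷_; _++_; length; filter)
open import Data.List.Membership.Propositional using (_∈_; _∉_; lose)
open import Data.List.Membership.Propositional.Properties using (∈-++⁺ˡ; ∈-++⁺ʳ; ∈-++⁻; ∈-filter⁺; ∈-filter⁻)
open import Data.List.Properties using (length-++; length-filter; filter-accept; filter-reject; filter-notAll)
open import Data.List.Relation.Unary.Any using (here; there)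
open import Data.List.Relation.Unary.Unique.Propositional using (Unique)
import Data.List.Relation.Unary.Unique.Propositional.Properties as Unique
open import Data.Nat using (ℕ; zero; suc; _+_; _⊔_; _≤_)
open import Data.Nat.Properties
open import Data.Product using (Σ; _×_; _,_; proj₁; proj₂; swap)
open import Data.Sum using (inj₁; inj₂; [_,_]′)
import Data.Sum as Sum
open import Relation.Nullary using (¬_; Dec; yes; no)
open import Relation.Unary using (Decidable; Empty; _∩_; _∪_; _≬_)
open import Relation.Binary.PropositionalEquality
  using (_≡_; refl; sym; trans; cong; cong₂; module ≡-Reasoning)

module _ (Γ : Graph) where
  open Graph Γ

  infix 4 _≈_
  _≈_ : (V → Set) → (V → Set) → Set
  _≈_ = _≐_ Γ

  ≈-sym : ∀ {X Y} → X ≈ Y → Y ≈ X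
  ≈-sym = swap

  ≈-trans : ∀ {X Y Z} → X ≈ Y → Y ≈ Z → X ≈ Z
  ≈-trans (X⊆Y , Y⊆X) (Y⊆Z , Z⊆Y) = (λ v x → Y⊆Z v (X⊆Y v x)) , (λ v z → Y⊆X v (Z⊆Y v z))

  head∉ : ∀ {K u v} → Path Γ K u v → u ∉ K
  head∉ (stop u∉K)     = u∉K
  head∉ (step u∉K _ _) = u∉K

  last∉ : ∀ {K u v} → Path Γ K u v → v ∉ K
  last∉ (stop v∉K)   = v∉K
  last∉ (step _ _ p) = last∉ p

  infixr 5 _++ᵖ_
  _++ᵖ_ : ∀ {K u v w} → Path Γ K u v → Path Γ K v w → Path Γ K u w
  stop _       ++ᵖ q = q
  step h u~w p ++ᵖ q = step h u~w (p ++ᵖ q)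

  extend : ∀ {K u v w} → Path Γ K u v → v ~ w → w ∉ K → Path Γ K u w
  extend p v~w w∉K = p ++ᵖ step (last∉ p) v~w (stop w∉K)

  reverse : ∀ {K u v} → Path Γ K u v → Path Γ K v u
  reverse (stop u∉K)       = stop u∉K
  reverse (step u∉K u~w p) = extend (reverse p) (~-sym u~w) u∉K

  componentOf : List V → V → V → Set
  componentOf K u = Path Γ K u

  componentOf-isComponent : ∀ {K u} → u ∉ K → IsComponent Γ K (componentOf K u)
  componentOf-isComponent {u = u} u∉K =
    (u , stop u∉K) , (λ _ → last∉) , (λ _ _ p q → reverse p ++ᵖ q) , (λ _ _ p q → p ++ᵖ q)

  module _ {K : List V} {C : V → Set} (cC : IsComponent Γ K C) where

    component-avoids : ∀ {v} → C v → v ∉ K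
    component-avoids = proj₁ (proj₂ cC) _

    component-connected : ∀ {u v} → C u → C v → Path Γ K u v
    component-connected = proj₁ (proj₂ (proj₂ cC)) _ _

    component-closed : ∀ {u v} → C u → Path Γ K u v → C v
    component-closed = proj₂ (proj₂ (proj₂ cC)) _ _

    component-step : ∀ {u w} → C u → u ~ w → w ∉ K → C w
    component-step cu u~w w∉K = component-closed cu (step (component-avoids cu) u~w (stop w∉K))

  components-≈ : ∀ {K C D v} → IsComponent Γ K C → IsComponent Γ K D → C v → D v → C ≈ D
  components-≈ cC cD cv dv =
    (λ _ cu → component-closed cD dv (component-connected cC cv cu)) ,
    (λ _ du → component-closed cC cv (component-connected cD dv du))

  distinct-components-disjoint : ∀ {K C D} → IsComponent Γ K C → IsComponent Γ K D →
                                 ¬ C ≈ D → Empty (C ∩ D)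
  distinct-components-disjoint cC cD C≉D _ (cv , dv) = C≉D (components-≈ cC cD cv dv)

  Path-within : ∀ {K L Z u v} → IsComponent Γ K Z → ¬ Z ≬ (_∈ L) → Z u →
                Path Γ K u v → Path Γ L u v
  Path-within cZ Z∩L=∅ zu (stop _) = stop (λ u∈L → Z∩L=∅ (_ , zu , u∈L))
  Path-within cZ Z∩L=∅ zu (step _ u~w p) =
    step (λ u∈L → Z∩L=∅ (_ , zu , u∈L)) u~w
         (Path-within cZ Z∩L=∅ (component-step cZ zu u~w (head∉ p)) p)

  component-disjoint⇒Nested : ∀ {K L Z} → IsComponent Γ K Z → ¬ Z ≬ (_∈ L) → Nested Γ K L
  component-disjoint⇒Nested {Z = Z} cZ Z∩L=∅ with proj₁ cZ
  ... | z , zz = Z , componentOf _ z , cZ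
               , componentOf-isComponent (λ z∈L → Z∩L=∅ (z , zz , z∈L))
               , inj₁ (λ _ zv → Path-within cZ Z∩L=∅ zz (component-connected cZ zz zv))

  HasRay-∩-comm : ∀ {X Y} → HasRay Γ (X ∩ Y) → HasRay Γ (Y ∩ X)
  HasRay-∩-comm (r , inXY) = r , (λ m → swap (inXY m))

  ray-path : ∀ {K} (r : Ray Γ) → (∀ m → seq r m ∉ K) → ∀ m → Path Γ K (seq r 0) (seq r m)
  ray-path r avoids zero    = stop (avoids 0)
  ray-path r avoids (suc m) = extend (ray-path r avoids m) (adj r m) (avoids (suc m))

  disconnected-rays⇒EndCut : ∀ {N} (r r′ : Ray Γ) → (∀ m → seq r m ∉ N) → (∀ m → seq r′ m ∉ N) →
                              ¬ Path Γ N (seq r 0) (seq r′ 0) → EndCut Γ N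
  disconnected-rays⇒EndCut {N} r r′ avoids avoids′ apart =
    (seq r 0 , seq r′ 0 , avoids 0 , avoids′ 0 , apart) ,
    componentOf N (seq r 0) , componentOf N (seq r′ 0) ,
    componentOf-isComponent (avoids 0) , componentOf-isComponent (avoids′ 0) ,
    (λ same → apart (proj₂ same _ (stop (avoids′ 0)))) ,
    (r , ray-path r avoids) , (r′ , ray-path r′ avoids′)

  ray-from : ℕ → Ray Γ → Ray Γ
  ray-from n r = record
    { seq = λ m → seq r (m + n)
    ; inj = λ e → +-cancelʳ-≡ n _ _ (inj r e)
    ; adj = λ m → adj r (m + n)
    }

  ThirdComponent : List V → (V → Set) → (V → Set) → Set₁
  ThirdComponent K X Y = Σ (V → Set) λ Z → IsComponent Γ K Z × ¬ Z ≈ X × ¬ Z ≈ Y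

  ThreeOrMoreComponents : List V → Set₁
  ThreeOrMoreComponents K = ∀ X Y → ThirdComponent K X Y

  record Crossing (K L : List V) : Set₁ where
    constructor mkCrossing
    field
      C C′ D D′    : V → Set
      C-component  : IsComponent Γ K C
      C′-component : IsComponent Γ K C′
      D-component  : IsComponent Γ L D
      D′-component : IsComponent Γ L D′
      C≉C′         : ¬ C ≈ C′
      D≉D′         : ¬ D ≈ D′
      ray          : HasRay Γ (C ∩ D)
      ray′         : HasRay Γ (C′ ∩ D′)

  module Classical (em : ExcludedMiddle 0ℓ) (em₁ : ExcludedMiddle (Level.suc 0ℓ)) where

    dec : (P : V → Set) → Decidable P
    dec P _ = em

    length-filter-∪ : ∀ {P Q} → Empty (P ∩ Q) → ∀ xs →
      length (filter (dec P) xs) + length (filter (dec Q) xs) ≡ length (filter (dec (P ∪ Q)) xs)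
    length-filter-∪ P∩Q=∅ [] = refl
    length-filter-∪ {P} {Q} P∩Q=∅ (x ∷ xs) = by-cases (em {P x}) (em {Q x})
      where
      count count′ : (V → Set) → ℕ
      count R = length (filter (dec R) (x ∷ xs))
      count′ R = length (filter (dec R) xs)
      ih : count′ P + count′ Q ≡ count′ (P ∪ Q)
      ih = length-filter-∪ P∩Q=∅ xs
      open ≡-Reasoning
      by-cases : Dec (P x) → Dec (Q x) → count P + count Q ≡ count (P ∪ Q)
      by-cases (yes px) (yes qx) = ⊥-elim (P∩Q=∅ x (px , qx))
      by-cases (yes px) (no ¬qx) = begin
        count P + count Q
          ≡⟨ cong₂ (λ p q → length p + length q) (filter-accept (dec P) px) (filter-reject (dec Q) ¬qx) ⟩
        suc (count′ P + count′ Q)  ≡⟨ cong suc ih ⟩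
        suc (count′ (P ∪ Q))      ≡⟨ cong length (filter-accept (dec (P ∪ Q)) (inj₁ px)) ⟨
        count (P ∪ Q) ∎
      by-cases (no ¬px) (yes qx) = begin
        count P + count Q
          ≡⟨ cong₂ (λ p q → length p + length q) (filter-reject (dec P) ¬px) (filter-accept (dec Q) qx) ⟩
        count′ P + suc (count′ Q)  ≡⟨ +-suc _ _ ⟩
        suc (count′ P + count′ Q)  ≡⟨ cong suc ih ⟩
        suc (count′ (P ∪ Q))      ≡⟨ cong length (filter-accept (dec (P ∪ Q)) (inj₂ qx)) ⟨
        count (P ∪ Q) ∎
      by-cases (no ¬px) (no ¬qx) = begin
        count P + count Q
          ≡⟨ cong₂ (λ p q → length p + length q) (filter-reject (dec P) ¬px) (filter-reject (dec Q) ¬qx) ⟩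
        count′ P + count′ Q  ≡⟨ ih ⟩
        count′ (P ∪ Q)  ≡⟨ cong length (filter-reject (dec (P ∪ Q)) [ ¬px , ¬qx ]′) ⟨
        count (P ∪ Q) ∎

    -- Each vertex occurs at most once on a ray.
    ray-eventually-avoids : (r : Ray Γ) (K : List V) → ∃[ n ] (∀ m → n ≤ m → seq r m ∉ K)
    ray-eventually-avoids r [] = 0 , λ _ _ ()
    ray-eventually-avoids r (x ∷ K) with ray-eventually-avoids r K | em {∃[ i ] seq r i ≡ x}
    ... | n , avoids | no x∉r = n , λ where
      m _    (here rₘ≡x) → x∉r (m , rₘ≡x)
      m n≤m  (there rₘ∈K) → avoids m n≤m rₘ∈K
    ... | n , avoids | yes (i , rᵢ≡x) = suc i ⊔ n , λ where
      m le (here rₘ≡x) → <-irrefl (inj r (trans rᵢ≡x (sym rₘ≡x))) (≤-trans (m≤m⊔n (suc i) n) le)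
      m le (there rₘ∈K) → avoids m (≤-trans (m≤n⊔m (suc i) n) le) rₘ∈K

    ray-tail-in-component : ∀ K Q → HasRay Γ Q →
      Σ (V → Set) λ C → IsComponent Γ K C × HasRay Γ (C ∩ Q)
    ray-tail-in-component K Q (r , inQ) with ray-eventually-avoids r K
    ... | n , avoids = componentOf K (seq r n) , componentOf-isComponent (tail-avoids 0)
                     , ray-from n r , λ m → ray-path (ray-from n r) tail-avoids m , inQ (m + n)
      where
      tail-avoids : ∀ m → seq r (m + n) ∉ K
      tail-avoids m = avoids (m + n) (m≤n+m n m)

    -- (L ∩ (C ∪ K)) ∪ (K ∩ D): the vertex boundary of the corner C ∩ D, for
    -- components C of Γ - K and D of Γ - L.
    corner : List V → List V → (V → Set) → (V → Set) → List V
    corner K L C D = filter (dec (C ∪ (_∈ K))) L ++ filter (dec D) K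

    ∉-corner : ∀ {K L C D w} → w ∉ K → w ∉ L → w ∉ corner K L C D
    ∉-corner {K} {L} {C} w∉K w∉L w∈N with ∈-++⁻ (filter (dec (C ∪ (_∈ K))) L) w∈N
    ... | inj₁ w∈L′ = w∉L (proj₁ (∈-filter⁻ _ w∈L′))
    ... | inj₂ w∈K′ = w∉K (proj₁ (∈-filter⁻ _ w∈K′))

    corner-closed : ∀ {K L C D u v} → IsComponent Γ K C → IsComponent Γ L D →
                    Path Γ (corner K L C D) u v → (C ∩ D) u → (C ∩ D) v
    corner-closed cC cD (stop _) cdu = cdu
    corner-closed {K} {L} {C} {D} cC cD (step {w = w} _ u~w p) (cu , du) =
      corner-closed cC cD p (next (head∉ p))
      where
      next : w ∉ corner K L C D → (C ∩ D) w
      next w∉N with em {w ∈ L} | em {w ∈ K}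
      ... | yes w∈L | yes w∈K = ⊥-elim (w∉N (∈-++⁺ˡ (∈-filter⁺ _ w∈L (inj₂ w∈K))))
      ... | yes w∈L | no w∉K  =
        ⊥-elim (w∉N (∈-++⁺ˡ (∈-filter⁺ _ w∈L (inj₁ (component-step cC cu u~w w∉K)))))
      ... | no w∉L  | yes w∈K =
        ⊥-elim (w∉N (∈-++⁺ʳ _ (∈-filter⁺ _ w∈K (component-step cD du u~w w∉L))))
      ... | no w∉L  | no w∉K  = component-step cC cu u~w w∉K , component-step cD du u~w w∉L

    corner-EndCut : ∀ {K L C D C′ D′} → IsComponent Γ K C → IsComponent Γ L D →
                    IsComponent Γ K C′ → IsComponent Γ L D′ → Empty (C ∩ C′) →
                    HasRay Γ (C ∩ D) → HasRay Γ (C′ ∩ D′) → EndCut Γ (corner K L C D)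
    corner-EndCut cC cD cC′ cD′ C∩C′=∅ (r , inCD) (r′ , inC′D′) =
      disconnected-rays⇒EndCut r r′
        (λ m → ∉-corner (component-avoids cC (proj₁ (inCD m))) (component-avoids cD (proj₂ (inCD m))))
        (λ m → ∉-corner (component-avoids cC′ (proj₁ (inC′D′ m))) (component-avoids cD′ (proj₂ (inC′D′ m))))
        (λ p → C∩C′=∅ _ (proj₁ (corner-closed cC cD p (inCD 0)) , proj₁ (inC′D′ 0)))

    corner-Unique : ∀ {K L C D} → Unique K → Unique L → IsComponent Γ L D →
                    Unique (corner K L C D)
    corner-Unique {K} {L} {C} {D} uK uL cD =
      Unique.++⁺ (Unique.filter⁺ (dec (C ∪ (_∈ K))) uL) (Unique.filter⁺ (dec D) uK)
        λ (w∈L′ , w∈K′) → component-avoids cD (proj₂ (∈-filter⁻ (dec D) {xs = K} w∈K′))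
                                              (proj₁ (∈-filter⁻ (dec (C ∪ (_∈ K))) {xs = L} w∈L′))

    Crossing-impossible : ∀ {K L} → Mincut Γ K → Mincut Γ L → ThreeOrMoreComponents K →
                          (∀ Z → IsComponent Γ K Z → Z ≬ (_∈ L)) → Crossing K L → ⊥
    Crossing-impossible {K} {L} (uK , ecK , minK) (uL , _ , minL) third meets cr = no-room (third C C′)
      where
      open Crossing cr renaming (C-component to cC; C′-component to cC′; D-component to cD; D′-component to cD′)
      C∩C′=∅ : Empty (C ∩ C′)
      C∩C′=∅ = distinct-components-disjoint cC cC′ C≉C′
      D∩D′=∅ : Empty (D ∩ D′)
      D∩D′=∅ = distinct-components-disjoint cD cD′ D≉D′
      N N′ : List V
      N  = corner K L C D
      N′ = corner L K D′ C′
      a a′ d d′ : ℕ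
      a  = length (filter (dec (C ∪ (_∈ K))) L)
      a′ = length (filter (dec C′) L)
      d  = length (filter (dec D) K)
      d′ = length (filter (dec (D′ ∪ (_∈ L))) K)

      K≤N : length K ≤ length N
      K≤N = minK N (corner-Unique uK uL cD) (corner-EndCut cC cD cC′ cD′ C∩C′=∅ ray ray′)

      K≤N′ : length K ≤ length N′
      K≤N′ = minK N′ (corner-Unique uL uK cC′)
        (corner-EndCut cD′ cC′ cD cC (λ v (d′v , dv) → D∩D′=∅ v (dv , d′v))
                       (HasRay-∩-comm {C′} {D′} ray′) (HasRay-∩-comm {C} {D} ray))

      a+a′≡ : a + a′ ≡ length (filter (dec ((C ∪ (_∈ K)) ∪ C′)) L)
      a+a′≡ = length-filter-∪ (λ where v (inj₁ cv , c′v) → C∩C′=∅ v (cv , c′v)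
                                       v (inj₂ v∈K , c′v) → component-avoids cC′ c′v v∈K) L

      d+d′≡ : d + d′ ≡ length (filter (dec (D ∪ (D′ ∪ (_∈ L)))) K)
      d+d′≡ = length-filter-∪ (λ where v (dv , inj₁ d′v) → D∩D′=∅ v (dv , d′v)
                                       v (dv , inj₂ v∈L) → component-avoids cD dv v∈L) K

      no-room : ThirdComponent K C C′ → ⊥
      no-room (Z , cZ , Z≉C , Z≉C′) with meets Z cZ
      ... | z , zz , z∈L = <-irrefl refl (begin-strict
        length K + length K       ≤⟨ +-mono-≤ K≤N K≤N′ ⟩
        length N + length N′      ≡⟨ cong₂ _+_ (length-++ (filter _ L)) (trans (length-++ (filter _ K)) (+-comm d′ a′)) ⟩
        (a + d) + (a′ + d′)       ≡⟨ interchange +-commutativeSemigroup a d a′ d′ ⟩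
        (a + a′) + (d + d′)       ≡⟨ cong₂ _+_ a+a′≡ d+d′≡ ⟩
        length (filter (dec ((C ∪ (_∈ K)) ∪ C′)) L) + length (filter (dec (D ∪ (D′ ∪ (_∈ L)))) K)
                                  <⟨ +-mono-<-≤ (filter-notAll _ L (lose z∈L z∉CKC′)) (length-filter _ K) ⟩
        length L + length K       ≤⟨ +-monoˡ-≤ (length K) (minL K uK ecK) ⟩
        length K + length K       ∎)
        where
        open ≤-Reasoning
        z∉CKC′ : ¬ ((C ∪ (_∈ K)) ∪ C′) z
        z∉CKC′ = [ [ (λ cz → distinct-components-disjoint cZ cC Z≉C z (zz , cz))
                   , component-avoids cZ zz ]′
                 , (λ c′z → distinct-components-disjoint cZ cC′ Z≉C′ z (zz , c′z)) ]′

    crossing : ∀ {K L} → NoSlices Γ → Mincut Γ K → ThreeOrMoreComponents K → EndCut Γ L →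
               Crossing K L
    crossing {K} {L} noSlices mK third (_ , D₁ , D₂ , cD₁ , cD₂ , D₁≉D₂ , ray₁ , ray₂)
      with ray-tail-in-component K D₁ ray₁ | ray-tail-in-component K D₂ ray₂
    ... | C₁ , cC₁ , s₁ | C₂ , cC₂ , s₂ with em {C₁ ≈ C₂}
    ... | no C₁≉C₂ = mkCrossing C₁ C₂ D₁ D₂ cC₁ cC₂ cD₁ cD₂ C₁≉C₂ D₁≉D₂ s₁ s₂
    ... | yes C₁≈C₂ with third C₁ C₁
    ... | Z , cZ , Z≉C₁ , _ with ray-tail-in-component L Z (noSlices K mK Z cZ)
    ... | D , cD , s with em {D ≈ D₁}
    ... | no D≉D₁ =
      mkCrossing C₁ Z D₁ D cC₁ cZ cD₁ cD (λ e → Z≉C₁ (≈-sym e)) (λ e → D≉D₁ (≈-sym e))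
                 s₁ (HasRay-∩-comm {D} {Z} s)
    ... | yes D≈D₁ =
      mkCrossing C₂ Z D₂ D cC₂ cZ cD₂ cD (λ e → Z≉C₁ (≈-trans (≈-sym e) (≈-sym C₁≈C₂)))
                 (λ e → D₁≉D₂ (≈-sym (≈-trans e D≈D₁))) s₂ (HasRay-∩-comm {D} {Z} s)

    ¬BCut⇒ThreeOrMoreComponents : ∀ {K} → Mincut Γ K → ¬ BCut Γ K → ThreeOrMoreComponents K
    ¬BCut⇒ThreeOrMoreComponents {K} mK ¬bcut X Y with em₁ {ThirdComponent K X Y}
    ... | yes third = third
    ... | no none = ⊥-elim (¬bcut (mK , two-components (proj₂ (proj₁ (proj₂ mK)))))
      where
      X-or-Y : ∀ E → IsComponent Γ K E → E ≈ X ⊎ E ≈ Y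
      X-or-Y E cE with em {E ≈ X} | em {E ≈ Y}
      ... | yes E≈X | _       = inj₁ E≈X
      ... | no _    | yes E≈Y = inj₂ E≈Y
      ... | no E≉X  | no E≉Y  = ⊥-elim (none (E , cE , E≉X , E≉Y))

      covered : ∀ {A B X Y} → (∀ E → IsComponent Γ K E → E ≈ X ⊎ E ≈ Y) → A ≈ X → B ≈ Y →
                ∀ E → IsComponent Γ K E → E ≈ A ⊎ E ≈ B
      covered cover A≈X B≈Y E cE =
        Sum.map (λ e → ≈-trans e (≈-sym A≈X)) (λ e → ≈-trans e (≈-sym B≈Y)) (cover E cE)

      two-components : (∃[ A ] ∃[ B ] (IsComponent Γ K A × IsComponent Γ K B × ¬ A ≈ B
                                       × HasRay Γ A × HasRay Γ B)) →
                       ∃[ A ] ∃[ B ] (IsComponent Γ K A × IsComponent Γ K B × ¬ A ≈ B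
                                     × (∀ E → IsComponent Γ K E → E ≈ A ⊎ E ≈ B))
      two-components (A , B , cA , cB , A≉B , _) with X-or-Y A cA | X-or-Y B cB
      ... | inj₁ A≈X | inj₁ B≈X = ⊥-elim (A≉B (≈-trans A≈X (≈-sym B≈X)))
      ... | inj₂ A≈Y | inj₂ B≈Y = ⊥-elim (A≉B (≈-trans A≈Y (≈-sym B≈Y)))
      ... | inj₁ A≈X | inj₂ B≈Y = A , B , cA , cB , A≉B , covered X-or-Y A≈X B≈Y
      ... | inj₂ A≈Y | inj₁ B≈X =
        A , B , cA , cB , A≉B , covered (λ E cE → Sum.swap (X-or-Y E cE)) A≈Y B≈X

    mincuts-nested : ∀ {K L} → NoSlices Γ → Mincut Γ K → ThreeOrMoreComponents K → Mincut Γ L →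
                     Nested Γ K L
    mincuts-nested {K} {L} noSlices mK third mL with em₁ {Nested Γ K L}
    ... | yes nested = nested
    ... | no ¬nested =
      ⊥-elim (Crossing-impossible mK mL third meets (crossing noSlices mK third (proj₁ (proj₂ mL))))
      where
      meets : ∀ Z → IsComponent Γ K Z → Z ≬ (_∈ L)
      meets Z cZ with em {Z ≬ (_∈ L)}
      ... | yes Z∩L = Z∩L
      ... | no Z∩L=∅ = ⊥-elim (¬nested (component-disjoint⇒Nested cZ Z∩L=∅))

    mincut-ACut⊎BCut : NoSlices Γ → ∀ K → Mincut Γ K → ACut Γ K ⊎ BCut Γ K
    mincut-ACut⊎BCut noSlices K mK with em₁ {BCut Γ K}
    ... | yes bcut = inj₂ bcut
    ... | no ¬bcut =
      inj₁ (mK , λ L mL → mincuts-nested noSlices mK (¬BCut⇒ThreeOrMoreComponents mK ¬bcut) mL)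

mainTheorem8 : ExcludedMiddle 0ℓ → ExcludedMiddle (Level.suc 0ℓ) →
    (Γ : Graph) → Connected Γ → (∃[ K ] EndCut Γ K) → NoSlices Γ →
    ∀ (K : List (Graph.V Γ)) → Mincut Γ K → ACut Γ K ⊎ BCut Γ K
mainTheorem8 em em₁ Γ _ _ = Classical.mincut-ACut⊎BCut Γ em em₁
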